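{- Let $\mu:G\times H\to K$ be a graph homomorphism, where $K$ is square-free, $G$ and $H$ are connected, and $G$ is non-bipartite. Suppose $\mu$ has no $H$-extremal sets, and suppose there is $R\in\pi_{\mu(g_0,h_0)}(K)$ such that for every closed walk $C$ from $(g_0,h_0)$ in $G\times H$, $\overline{\mu(C)}=R^{i}$ for some $i\in\mathbb{Z}$. Then either (i) $\mu$ is constant on $V(G)\times\{h\}$ for some $h\in V(H)$, or (ii) for every walk $W$ in $G\times H$ starting at $(g_0,h_0)$, $\overline{\mu(W)}$ is a prefix of $R^{i}$ for some $i\in\mathbb{Z}$.
   Context: All graphs are finite, simple, loopless; every graph has at least two vertices and no isolated vertices. $G\times H$ is the tensor product (vertices $V(G)\times V(H)$, $(g,h)(g',h')$ an edge iff $gg'\in E(G)$ and $hh'\in E(H)$); $G\times h_0h_1$ is the subgraph induced by $V(G)\times\{h_0,h_1\}$. Square-free: no four pairwise distinct vertices $v_1,\dots,v_4$ with $v_1v_2,v_2v_3,v_3v_4,v_4v_1$ edges. $N_F(S)$ is the set of neighbors of vertices of $S$ in $F$, $N^2_F(S)=N_F(N_F(S))\setminus S$. An $H$-extremal set for $\mu$ is a pair $(S,h_0h_1)$ with $h_0h_1$ an oriented edge of $H$ and $S\subseteq V(G)\times\{h_1\}$ such that for some $a,b\in V(K)$: $\mu(S)=\{a\}$, $\mu(N_{G\times h_0h_1}(S))=\{b\}$, $N^2_{G\times h_0h_1}(S)\ne\emptyset$, and $a\notin\mu(N^2_{G\times h_0h_1}(S))$. A walk is a sequence of oriented edges each starting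 where the previous ends; $\overline{W}$ is the reduced walk obtained by repeatedly deleting consecutive pairs $e,e^{ -1}$. $\pi_v(K)$ is the group of closed reduced walks from $v$ with product $W\cdot W'=\overline{WW'}$; $R^i$ is the $i$-th power ($R^0$ empty, $R^{ -i}=(R^{ -1})^i$). A prefix of a walk is an initial segment of its edge sequence. -}

module Defs where

open import Data.Nat using (ℕ; zero; suc; _≤_)
open import Data.Integer using (ℤ; +_; -[1+_])
open import Data.Fin using (Fin; _≟_)
open import Data.Fin.Subset using (Subset; _∈_)
open import Data.List using (List; []; _∷_; _++_; reverse; foldl; drop)
open import Data.Product using (_×_; _,_; ∃; ∃-syntax; Σ)
open import Data.Sum using (_⊎_)
open import Data.Bool using (Bool)
open import Data.Unit using (⊤)
open import Relation.Nullary using (¬_; yes; no)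
open import Relation.Binary.PropositionalEquality using (_≡_; _≢_)

record Graph : Set₁ where
  field
    n      : ℕ
    E      : Fin n → Fin n → Set
    sym    : ∀ {x y} → E x y → E y x
    irrefl : ∀ x → ¬ E x x
    two    : 2 ≤ n
    noIso  : ∀ x → ∃[ y ] E x y

open Graph public

V : Graph → Set
V G = Fin (n G)

-- Since graphs are simple, an oriented edge is determined by
-- its endpoints; a walk from s is represented by its start vertex s
-- and the list of the vertices it visits after s (the heads of its
-- successive oriented edges).

data IsWalk {A : Set} (R : A → A → Set) : A → List A → Set where
  nil  : ∀ {s} → IsWalk R s []
  cons : ∀ {s x xs} → R s x → IsWalk R x xs → IsWalk R s (x ∷ xs)

endpoint : {A : Set} → A → List A → A
endpoint s []       = s
endpoint s (x ∷ xs) = endpoint x xs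

ProdV : Graph → Graph → Set
ProdV G H = V G × V H

ProdE : (G H : Graph) → ProdV G H → ProdV G H → Set
ProdE G H (g , h) (g' , h') = E G g g' × E H h h'

IsHom : (G H K : Graph) → (ProdV G H → V K) → Set
IsHom G H K μ = ∀ {u v} → ProdE G H u v → E K (μ u) (μ v)

mapWalk : {A B : Set} → (A → B) → List A → List B
mapWalk f []       = []
mapWalk f (x ∷ xs) = f x ∷ mapWalk f xs

-- Reduced walk W̄ (deleting consecutive pairs e, e⁻¹, i.e. patterns
-- x, y, x in the vertex sequence), computed by the standard stack
-- algorithm.  The accumulator is the reversed vertex sequence of the
-- reduced prefix (its last element is always the start vertex).

module _ {k : ℕ} where
  private
    push : List (Fin k) → Fin k → List (Fin k)
    push (y ∷ x ∷ rest) w with w ≟ x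
    ... | yes _ = x ∷ rest
    ... | no  _ = w ∷ y ∷ x ∷ rest
    push acc w = w ∷ acc

  reduce : Fin k → List (Fin k) → List (Fin k)
  reduce s W = drop 1 (reverse (foldl push (s ∷ []) W))

  data ReducedSeq : List (Fin k) → Set where
    done0 : ReducedSeq []
    done1 : ∀ {a} → ReducedSeq (a ∷ [])
    done2 : ∀ {a b} → ReducedSeq (a ∷ b ∷ [])
    step  : ∀ {a b c rest} → a ≢ c → ReducedSeq (b ∷ c ∷ rest) →
            ReducedSeq (a ∷ b ∷ c ∷ rest)

  mult : Fin k → List (Fin k) → List (Fin k) → List (Fin k)
  mult v W W' = reduce v (W ++ W')

  inv : Fin k → List (Fin k) → List (Fin k)
  inv v W = drop 1 (reverse (v ∷ W))

  powℕ : Fin k → List (Fin k) → ℕ → List (Fin k)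
  powℕ v R zero    = []
  powℕ v R (suc i) = mult v (powℕ v R i) R

  pow : Fin k → List (Fin k) → ℤ → List (Fin k)
  pow v R (+ i)      = powℕ v R i
  pow v R -[1+ i ]   = powℕ v (inv v R) (suc i)

InPi : (K : Graph) → V K → List (V K) → Set
InPi K v R = IsWalk (E K) v R × endpoint v R ≡ v × ReducedSeq (v ∷ R)

IsPrefix : {A : Set} → List A → List A → Set
IsPrefix {A} W W' = Σ (List A) λ t → W' ≡ W ++ t

Connected : Graph → Set
Connected G = ∀ (x y : V G) → Σ (List (V G)) λ W → IsWalk (E G) x W × endpoint x W ≡ y

Bipartite : Graph → Set
Bipartite G = Σ (V G → Bool) λ c → ∀ {x y} → E G x y → c x ≢ c y

SquareFree : Graph → Set
SquareFree K = ∀ (v₁ v₂ v₃ v₄ : V K) →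
  v₁ ≢ v₂ → v₁ ≢ v₃ → v₁ ≢ v₄ → v₂ ≢ v₃ → v₂ ≢ v₄ → v₃ ≢ v₄ →
  ¬ (E K v₁ v₂ × E K v₂ v₃ × E K v₃ v₄ × E K v₄ v₁)

-- S ⊆ V(G) × {h₁} is given as a subset of V(G).
-- In G × h₀h₁ (h₀ ≠ h₁, H loopless) edges are exactly
-- (g,h₀)(g',h₁) with gg' ∈ E(G), so
--   N(S)  = { (g',h₀) | ∃ g ∈ S, gg' ∈ E(G) }
--   N²(S) = { (g'',h₁) | ∃ (g',h₀) ∈ N(S), g'g'' ∈ E(G) } ∖ S.

module _ (G : Graph) where
  InN : Subset (n G) → V G → Set
  InN S g' = ∃[ g ] (g ∈ S × E G g g')

  InN2 : Subset (n G) → V G → Set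
  InN2 S g'' = (∃[ g' ] (InN S g' × E G g' g'')) × ¬ (g'' ∈ S)

HExtremal : (G H K : Graph) → (ProdV G H → V K) →
            Subset (n G) → V H → V H → Set
HExtremal G H K μ S h₀ h₁ =
  E H h₀ h₁ ×
  Σ (V K) λ a → Σ (V K) λ b →
    ((∃[ g ] g ∈ S) × (∀ g → g ∈ S → μ (g , h₁) ≡ a)) ×
    ((∃[ g' ] InN G S g') × (∀ g' → InN G S g' → μ (g' , h₀) ≡ b)) ×
    (∃[ g'' ] InN2 G S g'') ×
    (∀ g'' → InN2 G S g'' → μ (g'' , h₁) ≢ a)

NoHExtremal : (G H K : Graph) → (ProdV G H → V K) → Set
NoHExtremal G H K μ = ∀ S h₀ h₁ → ¬ HExtremal G H K μ S h₀ h₁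

module Submission where

-- Reduced walks are computed by a stack (Defs.reduce),
-- and prefixes of reduced walks are suffixes of stacks.  The stacks of the powers
-- of R grow by a fixed period, so only boundedly many exponents need to be checked;
-- hence we may argue by contradiction.  If the image stack of W sits at the bottom
-- of no power's stack, no closed walk extending W keeps it there.  But a walk whose
-- image stack is a ∷ b ∷ … can always be extended so as to push a new entry:
-- otherwise the vertices reached in its layer with that stack form an H-extremal
-- set or, having no second neighbours, all of V(G) (G is connected and not
-- bipartite), so that layer is constant.  After pushing enough entries, the walk
-- back to z₀, of uniformly bounded length, can no longer uncover the image of W.

open import Defs renaming (sym to graph-sym)
open import Data.Bool using (Bool; true; false)
open import Data.Empty using (⊥; ⊥-elim)
open import Data.Fin using (Fin; _≟_; toℕ; fromℕ<) renaming (zero to fzero; suc to fsuc)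
open import Data.Fin.Properties using (any?; all?; toℕ-fromℕ<)
open import Data.Fin.Subset using (Subset; _∈_)
open import Data.Fin.Subset.Properties using (_∈?_)
open import Data.Integer using (ℤ; +_; -[1+_])
open import Data.List using (List; []; _∷_; _++_; _∷ʳ_; reverse; foldl; drop; length; initLast; _∷ʳ′_)
open import Data.List.Properties
  using (∷-injective; ∷ʳ-injectiveˡ; foldl-++; reverse-++; unfold-reverse; length-++; length-++-≤ˡ;
         ++-assoc; ++-identityʳ; length-reverse; reverse-involutive)
open import Data.Nat using (ℕ; zero; suc; _+_; _⊔_; _≤_; _<_; z≤n; s≤s; _≤?_; parity)
open import Data.Nat.Properties hiding (_≟_)
open import Data.Parity using (Parity; 0ℙ; 1ℙ) renaming (_+_ to _+ₚ_)
open import Data.Parity.Properties using (+-homo-+) renaming (_≟_ to _≟ₚ_)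
open import Data.Product using (_×_; _,_; Σ; ∃-syntax; proj₁; proj₂)
open import Data.Sum using (_⊎_; inj₁; inj₂)
open import Data.Unit using (⊤; tt)
open import Data.Vec using (tabulate)
open import Data.Vec.Properties using (lookup∘tabulate; []=⇒lookup; lookup⇒[]=)
open import Relation.Binary.Definitions using (DecidableEquality)
open import Relation.Binary.PropositionalEquality
open import Relation.Nullary using (¬_; Dec; yes; no; does)
open import Relation.Nullary.Decidable using (dec-true; ¬¬-excluded-middle)

-- `xs` is a final segment of `ys`.  Stacks store reduced walks reversed, so
-- prefixes of reduced walks correspond to suffixes of their stacks.
Suffix : {A : Set} → List A → List A → Set
Suffix {A} xs ys = Σ (List A) λ t → ys ≡ t ++ xs

suffix-refl : {A : Set} (xs : List A) → Suffix xs xs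
suffix-refl xs = [] , refl

suffix-trans : {A : Set} {xs ys zs : List A} → Suffix xs ys → Suffix ys zs → Suffix xs zs
suffix-trans {xs = xs} (t , refl) (u , refl) = u ++ t , sym (++-assoc u t xs)

suffix-length : {A : Set} {xs ys : List A} → Suffix xs ys → length xs ≤ length ys
suffix-length {xs = xs} (t , refl) =
  ≤-trans (m≤n+m (length xs) (length t)) (≤-reflexive (sym (length-++ t)))

reverse-∷-++ : {A : Set} (L : List A) (w : A) (X : List A) → reverse L ++ w ∷ X ≡ reverse (w ∷ L) ++ X
reverse-∷-++ L w X = trans (sym (++-assoc (reverse L) (w ∷ []) X)) (cong (_++ X) (sym (unfold-reverse w L)))

++-split : {X : Set} (A B C D : List X) → A ++ B ≡ C ++ D → length C ≤ length A →
           Σ (List X) λ E → (A ≡ C ++ E) × (D ≡ E ++ B)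
++-split A B [] D eq _ = A , refl , sym eq
++-split (a ∷ A) B (c ∷ C) D eq (s≤s le) with ∷-injective eq
... | refl , eq′ with ++-split A B C D eq′ le
...   | E , eqA , eqD = E , cong (a ∷_) eqA , eqD

suffix-compare : {A : Set} {xs ys zs : List A} → Suffix xs zs → Suffix ys zs →
                 length xs ≤ length ys → Suffix xs ys
suffix-compare {xs = xs} {ys} (t , refl) (u , eq) le
  with ++-split t xs u ys eq (+-cancelʳ-≤ (length xs) (length u) (length t) lengths)
  where
  lengths : length u + length xs ≤ length t + length xs
  lengths = begin
    length u + length xs   ≤⟨ +-monoʳ-≤ (length u) le ⟩
    length u + length ys   ≡⟨ sym (length-++ u) ⟩
    length (u ++ ys)       ≡⟨ cong length (sym eq) ⟩
    length (t ++ xs)       ≡⟨ length-++ t ⟩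
    length t + length xs   ∎
    where open ≤-Reasoning
... | E , _ , eqys = E , eqys

reverse-head : {A : Set} (s w : A) (R : List A) → Σ (List A) λ T → reverse (w ∷ R) ≡ endpoint s (w ∷ R) ∷ T
reverse-head s w [] = [] , refl
reverse-head s w (x ∷ R) with reverse-head w x R
... | T , eq = T ∷ʳ w , trans (unfold-reverse w (x ∷ R)) (cong (_∷ʳ w) eq)

reverse-middle : {A : Set} (a : A) (M : List A) (z : A) → reverse (a ∷ M ∷ʳ z) ≡ z ∷ reverse M ∷ʳ a
reverse-middle a M z = trans (unfold-reverse a (M ∷ʳ z)) (cong (_∷ʳ a) (reverse-++ M (z ∷ [])))

two-heads : {A : Set} (L : List A) → 2 ≤ length L → Σ A λ a → Σ A λ b → Σ (List A) λ r → L ≡ a ∷ b ∷ r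
two-heads (a ∷ b ∷ r) _ = a , b , r , refl
two-heads (a ∷ []) (s≤s ())

isPrefix? : {A : Set} → DecidableEquality A → (xs ys : List A) → Dec (IsPrefix xs ys)
isPrefix? _≟ₐ_ [] ys = yes (ys , refl)
isPrefix? _≟ₐ_ (x ∷ xs) [] = no λ { (_ , ()) }
isPrefix? _≟ₐ_ (x ∷ xs) (y ∷ ys) with x ≟ₐ y
... | no x≢y = no λ { (_ , eq) → x≢y (sym (proj₁ (∷-injective eq))) }
... | yes refl with isPrefix? _≟ₐ_ xs ys
...   | yes (t , eq) = yes (t , cong (x ∷_) eq)
...   | no ¬pre = no λ { (t , eq) → ¬pre (t , proj₂ (∷-injective eq)) }

HeadsDiffer : {A : Set} → List A → List A → Set
HeadsDiffer (w ∷ _) (a ∷ _) = w ≢ a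
HeadsDiffer _ _ = ⊤

heads-differ-resp : {A : Set} (L : List A) {a : A} {Y Z : List A} → HeadsDiffer L (a ∷ Y) → HeadsDiffer L (a ∷ Z)
heads-differ-resp [] _ = tt
heads-differ-resp (_ ∷ _) w≢a = w≢a

record CommonPrefix {A : Set} (xs ys : List A) : Set where
  field
    common restˡ restʳ : List A
    splitˡ : xs ≡ common ++ restˡ
    splitʳ : ys ≡ common ++ restʳ
    differ : HeadsDiffer restˡ restʳ

commonPrefix : {A : Set} → DecidableEquality A → (xs ys : List A) → CommonPrefix xs ys
commonPrefix _≟ₐ_ [] ys =
  record { common = [] ; restˡ = [] ; restʳ = ys ; splitˡ = refl ; splitʳ = refl ; differ = tt }
commonPrefix _≟ₐ_ (x ∷ xs) [] =
  record { common = [] ; restˡ = x ∷ xs ; restʳ = [] ; splitˡ = refl ; splitʳ = refl ; differ = tt }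
commonPrefix _≟ₐ_ (x ∷ xs) (y ∷ ys) with x ≟ₐ y
... | no x≢y =
  record { common = [] ; restˡ = x ∷ xs ; restʳ = y ∷ ys ; splitˡ = refl ; splitʳ = refl ; differ = x≢y }
... | yes refl = record { common = x ∷ common ; restˡ = restˡ ; restʳ = restʳ
                        ; splitˡ = cong (x ∷_) splitˡ ; splitʳ = cong (x ∷_) splitʳ ; differ = differ }
  where open CommonPrefix (commonPrefix _≟ₐ_ xs ys)

half-palindrome : {A : Set} (F P X Y : List A) → F ≡ P ++ X → reverse F ≡ P ++ Y →
                  length X ≤ length P → X ≡ Y
half-palindrome F P X Y refl revF X≤P
  with ++-split P Y (reverse X) (reverse P) (trans (sym revF) (reverse-++ P X))
                (≤-trans (≤-reflexive (length-reverse X)) X≤P)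
... | E , P≡ , revP≡ with ++-split E Y (reverse E) X E-eq (≤-reflexive (length-reverse E))
  where
  E-eq : E ++ Y ≡ reverse E ++ X
  E-eq = trans (sym revP≡) (trans (cong reverse P≡)
           (trans (reverse-++ (reverse X) E) (cong (reverse E ++_) (reverse-involutive X))))
...   | E′ , E≡ , X≡ = trans X≡ (cong (_++ Y) (empty E′ lengthE′))
  where
  lengthE′ : length E′ ≡ 0
  lengthE′ = +-cancelˡ-≡ (length E) (length E′) 0 (begin
    length E + length E′           ≡⟨ cong (_+ length E′) (sym (length-reverse E)) ⟩
    length (reverse E) + length E′ ≡⟨ sym (length-++ (reverse E)) ⟩
    length (reverse E ++ E′)       ≡⟨ cong length (sym E≡) ⟩
    length E                       ≡⟨ sym (+-identityʳ (length E)) ⟩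
    length E + 0                   ∎)
    where open ≡-Reasoning
  empty : ∀ (L : List _) → length L ≡ 0 → L ≡ []
  empty [] _ = refl

bounded-search : (Q : ℕ → Set) → (∀ j → Dec (Q j)) → ∀ J → Σ ℕ Q ⊎ (∀ j → j ≤ J → ¬ Q j)
bounded-search Q Q? J with any? (λ (i : Fin (suc J)) → Q? (toℕ i))
... | yes (i , q) = inj₁ (toℕ i , q)
... | no none = inj₂ λ j j≤J qj → none (fromℕ< (s≤s j≤J) , subst Q (sym (toℕ-fromℕ< (s≤s j≤J))) qj)

finite-bound : ∀ n (f : Fin n → ℕ) → Σ ℕ λ M → ∀ i → f i ≤ M
finite-bound zero f = 0 , λ ()
finite-bound (suc n) f with finite-bound n (λ i → f (fsuc i))
... | M , bound = f fzero ⊔ M , λ { fzero → m≤m⊔n (f fzero) M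
                                 ; (fsuc i) → ≤-trans (bound i) (m≤n⊔m (f fzero) M) }

BoundedExp : ℕ → ℤ → Set
BoundedExp J i = Σ ℕ λ j → j ≤ J × (i ≡ + j ⊎ i ≡ -[1+ j ])

search-exponents : {A : Set} → DecidableEquality A → (f : ℤ → List A) (xs : List A) (J : ℕ) →
                   (Σ ℤ λ i → IsPrefix xs (f i)) ⊎ (∀ i → BoundedExp J i → ¬ IsPrefix xs (f i))
search-exponents _≟ₐ_ f xs J
  with bounded-search (λ j → IsPrefix xs (f (+ j))) (λ j → isPrefix? _≟ₐ_ xs (f (+ j))) J
     | bounded-search (λ j → IsPrefix xs (f -[1+ j ])) (λ j → isPrefix? _≟ₐ_ xs (f -[1+ j ])) J
... | inj₁ (j , p) | _ = inj₁ (+ j , p)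
... | inj₂ _ | inj₁ (j , p) = inj₁ (-[1+ j ] , p)
... | inj₂ noPos | inj₂ noNeg = inj₂ λ { _ (j , j≤J , inj₁ refl) → noPos j j≤J
                                      ; _ (j , j≤J , inj₂ refl) → noNeg j j≤J }

¬¬-decidable-on-Fin : ∀ n (P : Fin n → Set) → ¬ ¬ (∀ i → Dec (P i))
¬¬-decidable-on-Fin zero P undecidable = undecidable (λ ())
¬¬-decidable-on-Fin (suc n) P undecidable =
  ¬¬-excluded-middle λ P0? → ¬¬-decidable-on-Fin n (λ i → P (fsuc i)) λ Psuc? →
    undecidable λ { fzero → P0? ; (fsuc i) → Psuc? i }

module _ {n : ℕ} {P : Fin n → Set} (P? : ∀ i → Dec (P i)) where
  subsetOf : Subset n
  subsetOf = tabulate (λ i → does (P? i))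

  ∈-subsetOf : ∀ i → P i → i ∈ subsetOf
  ∈-subsetOf i p = lookup⇒[]= i subsetOf (trans (lookup∘tabulate _ i) (dec-true (P? i) p))

  subsetOf-∈ : ∀ i → i ∈ subsetOf → P i
  subsetOf-∈ i i∈ with P? i | trans (sym (lookup∘tabulate (λ j → does (P? j)) i)) ([]=⇒lookup i∈)
  ... | yes p | _ = p
  ... | no _ | ()

reduced-tail : ∀ {k} {a : Fin k} {l} → ReducedSeq (a ∷ l) → ReducedSeq l
reduced-tail done1 = done0
reduced-tail done2 = done1
reduced-tail (step _ r) = r

reduced-init : ∀ {k} (l : List (Fin k)) z → ReducedSeq (l ∷ʳ z) → ReducedSeq l
reduced-init [] z r = done0
reduced-init (a ∷ []) z r = done1
reduced-init (a ∷ b ∷ []) z r = done2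
reduced-init (a ∷ b ∷ c ∷ l) z (step a≢c r) = step a≢c (reduced-init (b ∷ c ∷ l) z r)

data NoLoop {A : Set} : List A → Set where
  noloop0 : NoLoop []
  noloop1 : ∀ {a} → NoLoop (a ∷ [])
  noloop-step : ∀ {a b l} → a ≢ b → NoLoop (b ∷ l) → NoLoop (a ∷ b ∷ l)

noLoop-tail : {A : Set} {a : A} {l : List A} → NoLoop (a ∷ l) → NoLoop l
noLoop-tail noloop1 = noloop0
noLoop-tail (noloop-step _ nl) = nl

noLoop-init : {A : Set} (l : List A) (z : A) → NoLoop (l ∷ʳ z) → NoLoop l
noLoop-init [] z _ = noloop0
noLoop-init (a ∷ []) z _ = noloop1
noLoop-init (a ∷ b ∷ l) z (noloop-step a≢b nl) = noloop-step a≢b (noLoop-init (b ∷ l) z nl)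

walk-noLoop : {A : Set} {E : A → A → Set} → (∀ x → ¬ E x x) → ∀ {s L} → IsWalk E s L → NoLoop (s ∷ L)
walk-noLoop irr nil = noloop1
walk-noLoop irr (cons {s} e w) = noloop-step (λ { refl → irr s e }) (walk-noLoop irr w)

-- A palindrome without loops and backtracks has at most one entry: peeling off
-- the two (equal) ends leaves a shorter such palindrome, and the innermost one
-- or two entries produce a loop or a backtrack.
palindrome-short : ∀ {k} n (L : List (Fin k)) → length L ≤ n → NoLoop L → ReducedSeq L →
                   reverse L ≡ L → length L ≤ 1
palindrome-short n [] _ _ _ _ = z≤n
palindrome-short zero (a ∷ L) () _ _ _
palindrome-short (suc n) (a ∷ L) (s≤s len) nl rs pal with initLast L
... | [] = s≤s z≤n
... | M ∷ʳ′ z with ∷-injective (trans (sym (reverse-middle a M z)) pal)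
...   | refl , mid = ⊥-elim (middle M (≤-trans (length-++-≤ˡ M) len) (∷ʳ-injectiveˡ (reverse M) M mid) nl rs)
  where
  middle : ∀ M → length M ≤ n → reverse M ≡ M → NoLoop (a ∷ M ∷ʳ a) → ReducedSeq (a ∷ M ∷ʳ a) → ⊥
  middle [] _ _ (noloop-step a≢a _) _ = a≢a refl
  middle (c ∷ []) _ _ _ (step a≢a _) = a≢a refl
  middle (c ∷ d ∷ M) lenM revM nl rs
    with palindrome-short n (c ∷ d ∷ M) lenM (noLoop-init (c ∷ d ∷ M) a (noLoop-tail nl))
                          (reduced-init (c ∷ d ∷ M) a (reduced-tail rs)) revM
  ... | s≤s ()

reduced-walk-not-palindrome : ∀ {k} {E : Fin k → Fin k → Set} → (∀ x → ¬ E x x) →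
  ∀ {v w R} → IsWalk E v (w ∷ R) → ReducedSeq (v ∷ w ∷ R) → reverse (v ∷ w ∷ R) ≢ v ∷ w ∷ R
reduced-walk-not-palindrome irr walk rs pal with palindrome-short _ _ ≤-refl (walk-noLoop irr walk) rs pal
... | s≤s ()

-- The stack computing Defs.reduce.  A stack is the reduced walk read so far,
-- reversed, above its start vertex; reading a vertex either cancels a backtrack
-- (pop) or extends the walk (push).
module Stack {k : ℕ} where

  -- `reduce` folds a (private) stack operation of Defs over the walk.  We recover
  -- that operation as the solution of the definitional equation below, so that
  -- `reduce v L` unfolds to `unstack (stack v L)`.
  private
    pushSpec : Σ (List (Fin k) → Fin k → List (Fin k)) λ f →
               ∀ v L → reduce v L ≡ drop 1 (reverse (foldl f (v ∷ []) L))
    pushSpec = _ , λ v L → refl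

  -- push w: pop the top if w equals the entry below it (a backtrack), else push w
  push : List (Fin k) → Fin k → List (Fin k)
  push = proj₁ pushSpec

  stack : Fin k → List (Fin k) → List (Fin k)
  stack v L = foldl push (v ∷ []) L

  unstack : List (Fin k) → List (Fin k)
  unstack S = drop 1 (reverse S)

  RS : List (Fin k) → Set
  RS = ReducedSeq {k}

  push-pop : ∀ y x r → push (y ∷ x ∷ r) x ≡ x ∷ r
  push-pop y x r with x ≟ x
  ... | yes _ = refl
  ... | no x≢x = ⊥-elim (x≢x refl)

  push-push : ∀ y x r w → w ≢ x → push (y ∷ x ∷ r) w ≡ w ∷ y ∷ x ∷ r
  push-push y x r w w≢x with w ≟ x
  ... | yes w≡x = ⊥-elim (w≢x w≡x)
  ... | no _ = refl

  push-top : ∀ S w → Σ (List (Fin k)) λ T → push S w ≡ w ∷ T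
  push-top [] w = [] , refl
  push-top (y ∷ []) w = y ∷ [] , refl
  push-top (y ∷ x ∷ r) w with w ≟ x
  ... | yes refl = r , refl
  ... | no _ = y ∷ x ∷ r , refl

  stack-top : ∀ v L → Σ (List (Fin k)) λ T → stack v L ≡ endpoint v L ∷ T
  stack-top v L = go L (v ∷ []) v ([] , refl)
    where
    go : ∀ L S s → (Σ (List (Fin k)) λ T → S ≡ s ∷ T) →
         Σ (List (Fin k)) λ T → foldl push S L ≡ endpoint s L ∷ T
    go [] S s top = top
    go (x ∷ L) S s _ = go L (push S x) x (push-top S x)

  push-reduced : ∀ S w → RS (w ∷ S) → push S w ≡ w ∷ S
  push-reduced [] w r = refl
  push-reduced (y ∷ []) w r = refl
  push-reduced (y ∷ x ∷ S) w (step w≢x _) = push-push y x S w w≢x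

  read-reduced : ∀ x y L S → RS (x ∷ y ∷ L) → foldl push (y ∷ x ∷ S) L ≡ reverse L ++ y ∷ x ∷ S
  read-reduced x y [] S r = refl
  read-reduced x y (w ∷ L) S (step x≢w r) = begin
    foldl push (push (y ∷ x ∷ S) w) L
      ≡⟨ cong (λ T → foldl push T L) (push-push y x S w (λ w≡x → x≢w (sym w≡x))) ⟩
    foldl push (w ∷ y ∷ x ∷ S) L        ≡⟨ read-reduced y w L (x ∷ S) r ⟩
    reverse L ++ w ∷ y ∷ x ∷ S          ≡⟨ reverse-∷-++ L w (y ∷ x ∷ S) ⟩
    reverse (w ∷ L) ++ y ∷ x ∷ S        ∎
    where open ≡-Reasoning

  WellFormed : Fin k → List (Fin k) → Set
  WellFormed v S = (Σ (List (Fin k)) λ M → S ≡ M ∷ʳ v) × RS S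

  push-wf : ∀ v S w → WellFormed v S → WellFormed v (push S w)
  push-wf v [] w (([] , ()) , _)
  push-wf v [] w ((_ ∷ _ , ()) , _)
  push-wf v (y ∷ []) w (([] , refl) , _) = (w ∷ [] , refl) , done2
  push-wf v (y ∷ []) w ((_ ∷ [] , ()) , _)
  push-wf v (y ∷ []) w ((_ ∷ _ ∷ _ , ()) , _)
  push-wf v (y ∷ x ∷ r) w ((M , eq) , rs) with w ≟ x
  push-wf v (y ∷ x ∷ r) w (([] , ()) , rs) | yes refl
  push-wf v (y ∷ x ∷ r) w ((_ ∷ M , eq) , rs) | yes refl = (M , proj₂ (∷-injective eq)) , reduced-tail rs
  push-wf v (y ∷ x ∷ r) w ((M , eq) , rs) | no w≢x = (w ∷ M , cong (w ∷_) eq) , step w≢x rs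

  stack-wf : ∀ v L → WellFormed v (stack v L)
  stack-wf v L = go L (v ∷ []) (([] , refl) , done1)
    where
    go : ∀ L S → WellFormed v S → WellFormed v (foldl push S L)
    go [] S wf = wf
    go (w ∷ L) S wf = go L (push S w) (push-wf v S w wf)

  stack-of-reduced : ∀ v R → RS (v ∷ R) → stack v R ≡ reverse (v ∷ R)
  stack-of-reduced v [] r = refl
  stack-of-reduced v (w ∷ L) r = begin
    foldl push (w ∷ v ∷ []) L    ≡⟨ read-reduced v w L [] r ⟩
    reverse L ++ w ∷ v ∷ []      ≡⟨ reverse-∷-++ L w (v ∷ []) ⟩
    reverse (w ∷ L) ∷ʳ v         ≡⟨ sym (unfold-reverse v (w ∷ L)) ⟩
    reverse (v ∷ w ∷ L)          ∎
    where open ≡-Reasoning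

  -- reversal preserves reducedness (the stack of a reduced walk is its reversal)
  reduced-reverse : ∀ v R → RS (v ∷ R) → RS (reverse (v ∷ R))
  reduced-reverse v R r = subst RS (stack-of-reduced v R r) (proj₂ (stack-wf v R))

  -- the vertex at the bottom is the start of the encoded walk, not part of it
  unstack-snoc : ∀ v M → unstack (M ∷ʳ v) ≡ reverse M
  unstack-snoc v M = cong (drop 1) (reverse-++ M (v ∷ []))

  restack : ∀ v S → WellFormed v S → stack v (unstack S) ≡ S
  restack v S ((M , refl) , r) = trans (cong (stack v) (unstack-snoc v M)) (rebuild M r)
    where
    rebuild : ∀ M → RS (M ∷ʳ v) → stack v (reverse M) ≡ M ∷ʳ v
    rebuild [] r = refl
    rebuild (w ∷ M) r = begin
      stack v (reverse (w ∷ M))              ≡⟨ cong (stack v) (unfold-reverse w M) ⟩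
      stack v (reverse M ∷ʳ w)               ≡⟨ foldl-++ push (v ∷ []) (reverse M) (w ∷ []) ⟩
      push (stack v (reverse M)) w           ≡⟨ cong (λ T → push T w) (rebuild M (reduced-tail r)) ⟩
      push (M ∷ʳ v) w                        ≡⟨ push-reduced (M ∷ʳ v) w r ⟩
      w ∷ M ∷ʳ v                             ∎
      where open ≡-Reasoning

  stack-reduce : ∀ v L → stack v (reduce v L) ≡ stack v L
  stack-reduce v L = restack v (stack v L) (stack-wf v L)

  -- stacks grow at the front, reduced walks at the end
  suffix-prefix : ∀ v S S′ → WellFormed v S → Suffix S S′ → IsPrefix (unstack S) (unstack S′)
  suffix-prefix v S S′ ((M , refl) , _) (t , refl) = reverse t , (begin
    unstack (t ++ M ∷ʳ v)              ≡⟨ cong unstack (sym (++-assoc t M (v ∷ []))) ⟩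
    unstack ((t ++ M) ∷ʳ v)            ≡⟨ unstack-snoc v (t ++ M) ⟩
    reverse (t ++ M)                   ≡⟨ reverse-++ t M ⟩
    reverse M ++ reverse t             ≡⟨ cong (_++ reverse t) (sym (unstack-snoc v M)) ⟩
    unstack (M ∷ʳ v) ++ reverse t      ∎)
    where open ≡-Reasoning

  push-step : ∀ S w → (Σ (Fin k) λ y → S ≡ y ∷ push S w) ⊎ Suffix S (push S w)
  push-step [] w = inj₂ (w ∷ [] , refl)
  push-step (y ∷ []) w = inj₂ (w ∷ [] , refl)
  push-step (y ∷ x ∷ r) w with w ≟ x
  ... | yes refl = inj₁ (y , refl)
  ... | no _ = inj₂ (w ∷ [] , refl)

  read-pops : ∀ L S → Σ (List (Fin k)) λ S′ →
              Suffix S′ S × Suffix S′ (foldl push S L) × length S ≤ length S′ + length L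
  read-pops [] S = S , suffix-refl S , suffix-refl S , ≤-reflexive (sym (+-identityʳ (length S)))
  read-pops (w ∷ L) S with push-step S w | read-pops L (push S w)
  ... | inj₁ (y , eq) | S′ , sfx , sfx′ , le =
        S′ , suffix-trans sfx (y ∷ [] , eq) , sfx′ ,
        ≤-trans (≤-reflexive (cong length eq)) (≤-trans (s≤s le) (≤-reflexive (sym (+-suc (length S′) (length L)))))
  ... | inj₂ grow | S′ , sfx , sfx′ , le with ≤-total (length S′) (length S)
  ...   | inj₁ S′≤S = S′ , suffix-compare sfx grow S′≤S , sfx′ ,
          ≤-trans (suffix-length grow) (≤-trans le (+-monoʳ-≤ (length S′) (n≤1+n (length L))))
  ...   | inj₂ S≤S′ = S , suffix-refl S , suffix-trans (suffix-compare grow sfx S≤S′) sfx′ ,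
          m≤m+n (length S) (suc (length L))

  push-backtrack : ∀ a b rest → RS (a ∷ b ∷ rest) → push (push (a ∷ b ∷ rest) b) a ≡ a ∷ b ∷ rest
  push-backtrack a b [] r rewrite push-pop a b [] = refl
  push-backtrack a b (c ∷ rest) (step a≢c _) rewrite push-pop a b (c ∷ rest) = push-push b c rest a a≢c

module Powers {k : ℕ} where
  open Stack {k}

  retrace-then-push : ∀ y CP Z L → RS (y ∷ CP ++ L) → HeadsDiffer L Z →
                      foldl push (y ∷ CP ++ Z) (CP ++ L) ≡ reverse L ++ drop (length CP) (y ∷ CP) ++ Z
  retrace-then-push y (c ∷ CP) Z L r hd =
    trans (cong (λ S → foldl push S (CP ++ L)) (push-pop y c (CP ++ Z)))
          (retrace-then-push c CP Z L (reduced-tail r) hd)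
  retrace-then-push y [] Z [] r hd = refl
  retrace-then-push y [] [] (w ∷ L) r hd = trans (read-reduced y w L [] r) (reverse-∷-++ L w (y ∷ []))
  retrace-then-push y [] (a ∷ Z) (w ∷ L) r w≢a =
    trans (cong (λ S → foldl push S L) (push-push y a Z w w≢a))
          (trans (read-reduced y w L (a ∷ Z) r) (reverse-∷-++ L w (y ∷ a ∷ Z)))

  -- Then v ∷ R and
  -- its reversal share a prefix `front` (R = C·X·C⁻¹ with X cyclically reduced),
  -- and the stack of R^(n+1) is `front ++ growth n`, where `growth` gains one
  -- nonempty period per step.
  module PowerStacks (v : Fin k) (R : List (Fin k)) (reduced : RS (v ∷ R))
                     (T : List (Fin k)) (closes : reverse R ≡ v ∷ T)
                     (notPal : reverse (v ∷ R) ≢ v ∷ R) where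

    powerStack : ℕ → List (Fin k)
    powerStack n = stack v (powℕ v R n)

    powerStack-suc : ∀ n → powerStack (suc n) ≡ foldl push (powerStack n) R
    powerStack-suc n = trans (stack-reduce v (powℕ v R n ++ R)) (foldl-++ push (v ∷ []) (powℕ v R n) R)

    reversed : reverse (v ∷ R) ≡ v ∷ T ∷ʳ v
    reversed = trans (unfold-reverse v R) (cong (_∷ʳ v) closes)

    open CommonPrefix (commonPrefix _≟_ R (T ∷ʳ v))

    front : List (Fin k)
    front = v ∷ common

    walk-split : v ∷ R ≡ front ++ restˡ
    walk-split = cong (v ∷_) splitˡ

    reversal-split : reverse (v ∷ R) ≡ front ++ restʳ
    reversal-split = trans reversed (cong (v ∷_) splitʳ)

    -- R is no palindrome, so the common prefix covers less than half of it
    front-short : length front < length restˡ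
    front-short with length restˡ ≤? length front
    ... | no ¬le = ≰⇒> ¬le
    ... | yes le = ⊥-elim (notPal (begin
      reverse (v ∷ R)   ≡⟨ reversal-split ⟩
      front ++ restʳ
        ≡⟨ cong (front ++_) (sym (half-palindrome (v ∷ R) front restˡ restʳ walk-split reversal-split le)) ⟩
      front ++ restˡ    ≡⟨ sym walk-split ⟩
      v ∷ R             ∎))
      where open ≡-Reasoning

    private
      coreSplit : Σ (List (Fin k)) λ core → (reverse restˡ ≡ front ++ core) × (restʳ ≡ core ++ reverse front)
      coreSplit = ++-split (reverse restˡ) (reverse front) front restʳ
        (trans (sym (reverse-++ front restˡ)) (trans (cong reverse (sym walk-split)) reversal-split))
        (≤-trans (n≤1+n (length front)) (≤-trans front-short (≤-reflexive (sym (length-reverse restˡ)))))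

    core : List (Fin k)
    core = proj₁ coreSplit

    -- the core is nonempty, again because front is short
    core-nonempty : Σ (Fin k) λ a → Σ (List (Fin k)) λ Q → core ≡ a ∷ Q
    core-nonempty with core | proj₁ (proj₂ coreSplit)
    ... | a ∷ Q | _ = a , Q , refl
    ... | [] | eq = ⊥-elim (<-irrefl refl (≤-trans front-short (≤-reflexive (begin
      length restˡ             ≡⟨ sym (length-reverse restˡ) ⟩
      length (reverse restˡ)   ≡⟨ cong length eq ⟩
      length (front ++ [])     ≡⟨ cong length (++-identityʳ front) ⟩
      length front             ∎))))
      where open ≡-Reasoning

    a : Fin k
    a = proj₁ core-nonempty

    Q : List (Fin k)
    Q = proj₁ (proj₂ core-nonempty)

    -- the last entry of front, where consecutive copies of the core are glued
    pivot : List (Fin k)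
    pivot = drop (length common) front

    growth : ℕ → List (Fin k)
    growth zero = a ∷ Q ++ reverse front
    growth (suc n) = (a ∷ Q ++ pivot) ++ growth n

    restˡ-reversed : reverse restˡ ≡ front ++ a ∷ Q
    restˡ-reversed = trans (proj₁ (proj₂ coreSplit)) (cong (front ++_) (proj₂ (proj₂ core-nonempty)))

    restʳ-shape : restʳ ≡ a ∷ Q ++ reverse front
    restʳ-shape = trans (proj₂ (proj₂ coreSplit)) (cong (_++ reverse front) (proj₂ (proj₂ core-nonempty)))

    growth-head : ∀ n → Σ (List (Fin k)) λ Z → growth n ≡ a ∷ Z
    growth-head zero = _ , refl
    growth-head (suc n) = _ , refl

    differ-growth : ∀ n → HeadsDiffer restˡ (growth n)
    differ-growth n rewrite proj₂ (growth-head n) =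
      heads-differ-resp restˡ (subst (HeadsDiffer restˡ) restʳ-shape differ)

    powerStack-shape : ∀ n → powerStack (suc n) ≡ front ++ growth n
    powerStack-shape zero = begin
      powerStack 1               ≡⟨ powerStack-suc 0 ⟩
      stack v R                  ≡⟨ stack-of-reduced v R reduced ⟩
      reverse (v ∷ R)            ≡⟨ reversal-split ⟩
      front ++ restʳ             ≡⟨ cong (front ++_) restʳ-shape ⟩
      front ++ growth 0          ∎
      where open ≡-Reasoning
    powerStack-shape (suc n) = begin
      powerStack (suc (suc n))                   ≡⟨ powerStack-suc (suc n) ⟩
      foldl push (powerStack (suc n)) R          ≡⟨ cong₂ (foldl push) (powerStack-shape n) splitˡ ⟩
      foldl push (v ∷ common ++ growth n) (common ++ restˡ)
        ≡⟨ retrace-then-push v common (growth n) restˡ (subst RS walk-split reduced) (differ-growth n) ⟩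
      reverse restˡ ++ pivot ++ growth n         ≡⟨ cong (_++ pivot ++ growth n) restˡ-reversed ⟩
      (front ++ a ∷ Q) ++ pivot ++ growth n      ≡⟨ ++-assoc front (a ∷ Q) (pivot ++ growth n) ⟩
      front ++ a ∷ Q ++ pivot ++ growth n        ≡⟨ cong (λ X → front ++ a ∷ X) (sym (++-assoc Q pivot (growth n))) ⟩
      front ++ growth (suc n)                    ∎
      where open ≡-Reasoning

    growth-mono : ∀ m n → m ≤ n → Suffix (growth m) (growth n)
    growth-mono m zero z≤n = suffix-refl _
    growth-mono m (suc n) m≤1+n with m≤n⇒m<n∨m≡n m≤1+n
    ... | inj₂ refl = suffix-refl _
    ... | inj₁ m<1+n = suffix-trans (growth-mono m n (≤-pred m<1+n)) (a ∷ Q ++ pivot , refl)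

    growth-length : ∀ n → suc n ≤ length (growth n)
    growth-length zero = s≤s z≤n
    growth-length (suc n) = ≤-trans (s≤s (growth-length n))
      (s≤s (≤-trans (m≤n+m (length (growth n)) (length (Q ++ pivot)))
                    (≤-reflexive (sym (length-++ (Q ++ pivot))))))

    -- A well-formed stack S at the bottom of the stack of some power of R is already
    -- at the bottom of the stack of a power with exponent at most its length j + 1:
    -- for larger exponents n + 1, both S and growth j are suffixes of the stack
    -- front ++ growth n, and growth j is at least as long as S.
    bounded : ∀ S n → WellFormed v S → Suffix S (powerStack n) →
              Σ ℕ λ j → j ≤ length S × Suffix S (powerStack j)
    bounded S zero _ sfx = zero , z≤n , sfx
    bounded S (suc n) wf sfx with suc n ≤? length S
    ... | yes le = suc n , le , sfx
    bounded S (suc n) ((M , refl) , _) sfx | no ¬le =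
      suc j , ≤-reflexive (sym length-S) ,
      subst (Suffix S) (sym (powerStack-shape j))
        (suffix-trans (suffix-compare sfx′ growth-sfx (≤-trans (≤-reflexive length-S) (growth-length j)))
                      (front , refl))
      where
      j = length M
      length-S : length (M ∷ʳ v) ≡ suc j
      length-S = trans (length-++ M) (+-comm j 1)
      sfx′ : Suffix (M ∷ʳ v) (front ++ growth n)
      sfx′ = subst (Suffix (M ∷ʳ v)) (powerStack-shape n) sfx
      j≤n : j ≤ n
      j≤n = ≤-trans (n≤1+n j) (≤-trans (≤-reflexive (sym length-S)) (≤-pred (≰⇒> ¬le)))
      growth-sfx : Suffix (growth j) (front ++ growth n)
      growth-sfx = suffix-trans (growth-mono j n j≤n) (front , refl)

  powℕ-empty : ∀ (v : Fin k) n → powℕ v [] n ≡ []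
  powℕ-empty v zero = refl
  powℕ-empty v (suc n) = cong (reduce v) (trans (++-identityʳ (powℕ v [] n)) (powℕ-empty v n))

  pow-empty : ∀ (v : Fin k) i → pow v [] i ≡ []
  pow-empty v (+ n) = powℕ-empty v n
  pow-empty v -[1+ n ] = powℕ-empty v (suc n)

  -- Negative powers are positive powers of the inverse walk, which is again
  -- closed, reduced and no palindrome.
  power-suffix-bounded : (E : Fin k → Fin k → Set) → (∀ x → ¬ E x x) →
    ∀ v R → IsWalk E v R → endpoint v R ≡ v → RS (v ∷ R) →
    ∀ S i → WellFormed v S → Suffix S (stack v (pow v R i)) →
    Σ ℤ λ i′ → BoundedExp (length S) i′ × Suffix S (stack v (pow v R i′))
  power-suffix-bounded E irr v [] _ _ _ S i _ sfx =
    + 0 , (0 , z≤n , inj₁ refl) , subst (λ P → Suffix S (stack v P)) (pow-empty v i) sfx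
  power-suffix-bounded E irr v (w ∷ R) walk closed red S i wf = bound i
    where
    T = proj₁ (reverse-head v w R)
    closes : reverse (w ∷ R) ≡ v ∷ T
    closes = trans (proj₂ (reverse-head v w R)) (cong (_∷ T) closed)
    notPal : reverse (v ∷ w ∷ R) ≢ v ∷ w ∷ R
    notPal = reduced-walk-not-palindrome irr walk red
    module Forward = PowerStacks v (w ∷ R) red T closes notPal

    R⁻ : List (Fin k)
    R⁻ = inv v (w ∷ R)
    R⁻-shape : R⁻ ≡ T ∷ʳ v
    R⁻-shape = cong (drop 1) Forward.reversed
    inverse-reversed : v ∷ R⁻ ≡ reverse (v ∷ w ∷ R)
    inverse-reversed = trans (cong (v ∷_) R⁻-shape) (sym Forward.reversed)
    red⁻ : RS (v ∷ R⁻)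
    red⁻ = subst RS (sym inverse-reversed) (reduced-reverse v (w ∷ R) red)
    closes⁻ : reverse R⁻ ≡ v ∷ reverse T
    closes⁻ = trans (cong reverse R⁻-shape) (reverse-++ T (v ∷ []))
    notPal⁻ : reverse (v ∷ R⁻) ≢ v ∷ R⁻
    notPal⁻ pal = notPal (sym (begin
      v ∷ w ∷ R                     ≡⟨ sym (reverse-involutive (v ∷ w ∷ R)) ⟩
      reverse (reverse (v ∷ w ∷ R)) ≡⟨ cong reverse (sym inverse-reversed) ⟩
      reverse (v ∷ R⁻)              ≡⟨ pal ⟩
      v ∷ R⁻                        ≡⟨ inverse-reversed ⟩
      reverse (v ∷ w ∷ R)           ∎))
      where open ≡-Reasoning
    module Backward = PowerStacks v R⁻ red⁻ (reverse T) closes⁻ notPal⁻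

    bound : ∀ i → Suffix S (stack v (pow v (w ∷ R) i)) →
            Σ ℤ λ i′ → BoundedExp (length S) i′ × Suffix S (stack v (pow v (w ∷ R) i′))
    bound (+ n) sfx with Forward.bounded S n wf sfx
    ... | j , j≤ , sfx′ = + j , (j , j≤ , inj₁ refl) , sfx′
    bound -[1+ n ] sfx with Backward.bounded S (suc n) wf sfx
    ... | zero , _ , sfx′ = + 0 , (0 , z≤n , inj₁ refl) , sfx′
    ... | suc j , j< , sfx′ = -[1+ j ] , (j , ≤-trans (n≤1+n j) j< , inj₂ refl) , sfx′

Walk : {A : Set} → (A → A → Set) → A → A → Set
Walk {A} E x y = Σ (List A) λ L → IsWalk E x L × endpoint x L ≡ y

len : {A : Set} {E : A → A → Set} {x y : A} → Walk E x y → ℕ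
len (L , _) = length L

endpoint-++ : {A : Set} (s : A) (X Y : List A) → endpoint s (X ++ Y) ≡ endpoint (endpoint s X) Y
endpoint-++ s [] Y = refl
endpoint-++ s (x ∷ X) Y = endpoint-++ x X Y

module _ {A B : Set} (f : A → B) where

  mapWalk-++ : ∀ X Y → mapWalk f (X ++ Y) ≡ mapWalk f X ++ mapWalk f Y
  mapWalk-++ [] Y = refl
  mapWalk-++ (x ∷ X) Y = cong (f x ∷_) (mapWalk-++ X Y)

  endpoint-mapWalk : ∀ s X → endpoint (f s) (mapWalk f X) ≡ f (endpoint s X)
  endpoint-mapWalk s [] = refl
  endpoint-mapWalk s (x ∷ X) = endpoint-mapWalk x X

  length-mapWalk : ∀ X → length (mapWalk f X) ≡ length X
  length-mapWalk [] = refl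
  length-mapWalk (x ∷ X) = cong suc (length-mapWalk X)

module _ {A : Set} {E : A → A → Set} where

  isWalk-++ : ∀ {s X Y} → IsWalk E s X → IsWalk E (endpoint s X) Y → IsWalk E s (X ++ Y)
  isWalk-++ nil q = q
  isWalk-++ (cons e p) q = cons e (isWalk-++ p q)

  infixr 5 _++ʷ_
  _++ʷ_ : ∀ {x y z} → Walk E x y → Walk E y z → Walk E x z
  (X , p , refl) ++ʷ (Y , q , end) = X ++ Y , isWalk-++ p q , trans (endpoint-++ _ X Y) end

  len-++ʷ : ∀ {x y z} (p : Walk E x y) (q : Walk E y z) → len (p ++ʷ q) ≡ len p + len q
  len-++ʷ (X , _ , refl) _ = length-++ X

  edge : ∀ {x y} → E x y → Walk E x y
  edge {y = y} e = y ∷ [] , cons e nil , refl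

  reverse-walk : (∀ {x y} → E x y → E y x) → ∀ {x L} → IsWalk E x L → Walk E (endpoint x L) x
  reverse-walk sym′ nil = [] , nil , refl
  reverse-walk sym′ (cons e p) = reverse-walk sym′ p ++ʷ edge (sym′ e)

  len-reverse-walk : (sym′ : ∀ {x y} → E x y → E y x) → ∀ {x L} (p : IsWalk E x L) →
                     len (reverse-walk sym′ p) ≡ length L
  len-reverse-walk sym′ nil = refl
  len-reverse-walk sym′ (cons e p) =
    trans (len-++ʷ (reverse-walk sym′ p) (edge (sym′ e)))
          (trans (+-comm _ 1) (cong suc (len-reverse-walk sym′ p)))

  reverseʷ : (∀ {x y} → E x y → E y x) → ∀ {x y} → Walk E x y → Walk E y x
  reverseʷ sym′ (_ , p , refl) = reverse-walk sym′ p

  len-reverseʷ : (sym′ : ∀ {x y} → E x y → E y x) → ∀ {x y} (W : Walk E x y) → len (reverseʷ sym′ W) ≡ len W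
  len-reverseʷ sym′ (_ , p , refl) = len-reverse-walk sym′ p

  bounce : ∀ {t y} → E t y → E y t → ℕ → Walk E t t
  bounce e e′ zero = [] , nil , refl
  bounce e e′ (suc d) = edge e ++ʷ edge e′ ++ʷ bounce e e′ d

  len-bounce : ∀ {t y} (e : E t y) (e′ : E y t) d → len (bounce e e′ d) ≡ d + d
  len-bounce e e′ zero = refl
  len-bounce e e′ (suc d) =
    trans (len-++ʷ (edge e) (edge e′ ++ʷ bounce e e′ d))
      (cong suc (trans (len-++ʷ (edge e′) (bounce e e′ d))
        (trans (cong suc (len-bounce e e′ d)) (sym (+-suc d d)))))

add-double-suc : ∀ m d → m + (suc d + suc d) ≡ suc (suc (m + (d + d)))
add-double-suc m d = trans (+-suc m (d + suc d)) (cong suc (trans (cong (λ x → m + x) (+-suc d d)) (+-suc m (d + d))))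

equal-parity-pad : ∀ m n → parity m ≡ parity n →
                   Σ ℕ λ d₁ → Σ ℕ λ d₂ → m + (d₁ + d₁) ≡ n + (d₂ + d₂)
equal-parity-pad zero zero _ = 0 , 0 , refl
equal-parity-pad zero (suc zero) ()
equal-parity-pad (suc zero) zero ()
equal-parity-pad (suc zero) (suc zero) _ = 0 , 0 , refl
equal-parity-pad m (suc (suc n)) e with equal-parity-pad m n e
... | d₁ , d₂ , eq = suc d₁ , d₂ , trans (add-double-suc m d₁) (cong (λ x → suc (suc x)) eq)
equal-parity-pad (suc (suc m)) n e with equal-parity-pad m n e
... | d₁ , d₂ , eq = d₁ , suc d₂ , trans (cong (λ x → suc (suc x)) eq) (sym (add-double-suc n d₂))

module _ (G H : Graph) where

  zip-walks : ∀ {g g′ h h′} (p : Walk (E G) g g′) (q : Walk (E H) h h′) → len p ≡ len q →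
              Walk (ProdE G H) (g , h) (g′ , h′)
  zip-walks (_ , p , refl) (_ , q , refl) = zip p q
    where
    zip : ∀ {g h X Y} → IsWalk (E G) g X → IsWalk (E H) h Y → length X ≡ length Y →
          Walk (ProdE G H) (g , h) (endpoint g X , endpoint h Y)
    zip nil nil _ = [] , nil , refl
    zip nil (cons _ _) ()
    zip (cons _ _) nil ()
    zip (cons e p) (cons e′ q) eq = edge (e , e′) ++ʷ zip p q (suc-injective eq)

OddClosedWalk : Graph → Set
OddClosedWalk G = Σ (V G) λ w → Σ (Walk (E G) w w) λ O → parity (len O) ≡ 1ℙ

isOdd : Parity → Bool
isOdd 0ℙ = false
isOdd 1ℙ = true

isOdd-injective : ∀ {p q} → isOdd p ≡ isOdd q → p ≡ q
isOdd-injective {0ℙ} {0ℙ} _ = refl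
isOdd-injective {1ℙ} {1ℙ} _ = refl
isOdd-injective {0ℙ} {1ℙ} ()
isOdd-injective {1ℙ} {0ℙ} ()

detour-parity : ∀ a b p → a +ₚ b ≢ p → a +ₚ (1ℙ +ₚ b) ≡ p
detour-parity 0ℙ 0ℙ 0ℙ neq = ⊥-elim (neq refl)
detour-parity 0ℙ 0ℙ 1ℙ _ = refl
detour-parity 0ℙ 1ℙ 0ℙ _ = refl
detour-parity 0ℙ 1ℙ 1ℙ neq = ⊥-elim (neq refl)
detour-parity 1ℙ 0ℙ 0ℙ _ = refl
detour-parity 1ℙ 0ℙ 1ℙ neq = ⊥-elim (neq refl)
detour-parity 1ℙ 1ℙ 0ℙ neq = ⊥-elim (neq refl)
detour-parity 1ℙ 1ℙ 1ℙ _ = refl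

module NonBipartite (G : Graph) (connected : Connected G) where

  -- colouring each vertex by the parity of a fixed walk to it from g₀ is a proper
  -- 2-colouring unless G has an odd closed walk
  odd-closed-walk : V G → ¬ Bipartite G → ¬ ¬ OddClosedWalk G
  odd-closed-walk g₀ nonBipartite noOdd = nonBipartite (colour , proper)
    where
    colour : V G → Bool
    colour x = isOdd (parity (len (connected g₀ x)))
    proper : ∀ {x y} → E G x y → colour x ≢ colour y
    proper {x} {y} e same = noOdd (g₀ , O , oddO)
      where
      α = connected g₀ x
      β = connected g₀ y
      O : Walk (E G) g₀ g₀
      O = α ++ʷ edge e ++ʷ reverseʷ (graph-sym G) β
      len-O : len O ≡ len α + (1 + len β)
      len-O = trans (len-++ʷ α (edge e ++ʷ reverseʷ (graph-sym G) β))
                (cong (λ l → len α + l) (trans (len-++ʷ (edge e) (reverseʷ (graph-sym G) β))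
                                        (cong suc (len-reverseʷ (graph-sym G) β))))
      p+1+p : ∀ p → p +ₚ (1ℙ +ₚ p) ≡ 1ℙ
      p+1+p 0ℙ = refl
      p+1+p 1ℙ = refl
      oddO : parity (len O) ≡ 1ℙ
      oddO = begin
        parity (len O)                                    ≡⟨ cong parity len-O ⟩
        parity (len α + (1 + len β))                      ≡⟨ +-homo-+ (len α) (1 + len β) ⟩
        parity (len α) +ₚ parity (1 + len β)              ≡⟨ cong (parity (len α) +ₚ_) (+-homo-+ 1 (len β)) ⟩
        parity (len α) +ₚ (1ℙ +ₚ parity (len β))
          ≡⟨ cong (λ p → parity (len α) +ₚ (1ℙ +ₚ p)) (sym (isOdd-injective same)) ⟩
        parity (len α) +ₚ (1ℙ +ₚ parity (len α))           ≡⟨ p+1+p (parity (len α)) ⟩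
        1ℙ                                                ∎
        where open ≡-Reasoning

  even-walk-transport : (P : V G → Set) → (∀ {g g′ g″} → P g → E G g g′ → E G g′ g″ → P g″) →
                        ∀ {x y} (W : Walk (E G) x y) → parity (len W) ≡ 0ℙ → P x → P y
  even-walk-transport P pass (_ , p , refl) = go p
    where
    go : ∀ {x L} → IsWalk (E G) x L → parity (length L) ≡ 0ℙ → P x → P (endpoint x L)
    go nil _ px = px
    go (cons e nil) () px
    go (cons e (cons e′ p)) even px = go p even (pass px e e′)

  -- with an odd closed walk, any two vertices are joined by walks of both parities:
  -- a detour around the odd closed walk flips the parity
  module WithOddWalk (odd : OddClosedWalk G) where
    walk-of-parity : ∀ x y p → Σ (Walk (E G) x y) λ W → parity (len W) ≡ p
    walk-of-parity x y p = choose (parity (len α) +ₚ parity (len β) ≟ₚ p)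
      where
      α = connected x (proj₁ odd)
      β = connected (proj₁ odd) y
      O = proj₁ (proj₂ odd)
      choose : Dec (parity (len α) +ₚ parity (len β) ≡ p) → Σ (Walk (E G) x y) λ W → parity (len W) ≡ p
      choose (yes eq) = α ++ʷ β , (begin
        parity (len (α ++ʷ β))             ≡⟨ cong parity (len-++ʷ α β) ⟩
        parity (len α + len β)             ≡⟨ +-homo-+ (len α) (len β) ⟩
        parity (len α) +ₚ parity (len β)   ≡⟨ eq ⟩
        p                                  ∎)
        where open ≡-Reasoning
      choose (no neq) = α ++ʷ O ++ʷ β , (begin
        parity (len (α ++ʷ O ++ʷ β))
          ≡⟨ cong parity (trans (len-++ʷ α (O ++ʷ β)) (cong (λ l → len α + l) (len-++ʷ O β))) ⟩
        parity (len α + (len O + len β))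
          ≡⟨ +-homo-+ (len α) (len O + len β) ⟩
        parity (len α) +ₚ parity (len O + len β)
          ≡⟨ cong (parity (len α) +ₚ_) (+-homo-+ (len O) (len β)) ⟩
        parity (len α) +ₚ (parity (len O) +ₚ parity (len β))
          ≡⟨ cong (λ q → parity (len α) +ₚ (q +ₚ parity (len β))) (proj₂ (proj₂ odd)) ⟩
        parity (len α) +ₚ (1ℙ +ₚ parity (len β))
          ≡⟨ detour-parity (parity (len α)) (parity (len β)) p neq ⟩
        p                                                   ∎)
        where open ≡-Reasoning

-- The walk pairs a walk in H with a walk in G
-- of the same parity (G has an odd closed walk), both padded to a common length by
-- bouncing along an edge at g₀ resp. h₀.
module ReturnWalks (G H : Graph) (connectedG : Connected G) (connectedH : Connected H)
                   (odd : OddClosedWalk G) (g₀ : V G) (h₀ : V H) where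
  open NonBipartite G connectedG
  open WithOddWalk odd

  return-walk : ∀ z → Walk (ProdE G H) z (g₀ , h₀)
  return-walk (g , h) = zip-walks G H (γ ++ʷ padG) (β ++ʷ padH) same-length
    where
    β = connectedH h h₀
    γ = proj₁ (walk-of-parity g g₀ (parity (len β)))
    pad = equal-parity-pad (len γ) (len β) (proj₂ (walk-of-parity g g₀ (parity (len β))))
    d₁ = proj₁ pad
    d₂ = proj₁ (proj₂ pad)
    eG = proj₂ (noIso G g₀)
    eH = proj₂ (noIso H h₀)
    padG = bounce eG (graph-sym G eG) d₁
    padH = bounce eH (graph-sym H eH) d₂
    same-length : len (γ ++ʷ padG) ≡ len (β ++ʷ padH)
    same-length = begin
      len (γ ++ʷ padG)       ≡⟨ len-++ʷ γ padG ⟩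
      len γ + len padG       ≡⟨ cong (λ l → len γ + l) (len-bounce eG (graph-sym G eG) d₁) ⟩
      len γ + (d₁ + d₁)      ≡⟨ proj₂ (proj₂ pad) ⟩
      len β + (d₂ + d₂)      ≡⟨ cong (λ l → len β + l) (sym (len-bounce eH (graph-sym H eH) d₂)) ⟩
      len β + len padH       ≡⟨ sym (len-++ʷ β padH) ⟩
      len (β ++ʷ padH)       ∎
      where open ≡-Reasoning

  return-bound : Σ ℕ λ M → ∀ z → len (return-walk z) ≤ M
  return-bound = proj₁ outer , λ (g , h) → ≤-trans (proj₂ (inner g) h) (proj₂ outer g)
    where
    inner : ∀ g → Σ ℕ λ M → ∀ h → len (return-walk (g , h)) ≤ M
    inner g = finite-bound (n H) (λ h → len (return-walk (g , h)))
    outer : Σ ℕ λ M → ∀ g → proj₁ (inner g) ≤ M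
    outer = finite-bound (n G) (λ g → proj₁ (inner g))

constant-layer? : (G H K : Graph) (μ : ProdV G H → V K) → V G →
                  Dec (∃[ h ] ∃[ c ] (∀ (g : V G) → μ (g , h) ≡ c))
constant-layer? G H K μ g₀ with any? (λ h → all? (λ g → μ (g , h) ≟ μ (g₀ , h)))
... | yes (h , same) = yes (h , μ (g₀ , h) , same)
... | no none = no λ { (h , c , const) → none (h , λ g → trans (const g) (sym (const g₀))) }

module Main (G H K : Graph) (μ : ProdV G H → V K)
            (connectedG : Connected G) (connectedH : Connected H)
            (noExtremal : NoHExtremal G H K μ)
            (g₀ : V G) (h₀ : V H) (R : List (V K)) (R∈π : InPi K (μ (g₀ , h₀)) R)
            (closed-powers : ∀ (C : List (ProdV G H)) → IsWalk (ProdE G H) (g₀ , h₀) C →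
               endpoint (g₀ , h₀) C ≡ (g₀ , h₀) →
               ∃[ i ] (reduce (μ (g₀ , h₀)) (mapWalk μ C) ≡ pow (μ (g₀ , h₀)) R i)) where

  open Stack {n K}
  open Powers {n K}

  z₀ : ProdV G H
  z₀ = g₀ , h₀

  v : V K
  v = μ z₀

  Γ : ProdV G H → ProdV G H → Set
  Γ = ProdE G H

  imageStack : List (ProdV G H) → List (V K)
  imageStack W = stack v (mapWalk μ W)

  imageStack-++ : ∀ W L → imageStack (W ++ L) ≡ foldl push (imageStack W) (mapWalk μ L)
  imageStack-++ W L = trans (cong (stack v) (mapWalk-++ μ W L)) (foldl-++ push (v ∷ []) (mapWalk μ W) (mapWalk μ L))

  image-top : ∀ W {a T} → imageStack W ≡ a ∷ T → μ (endpoint z₀ W) ≡ a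
  image-top W eq with stack-top v (mapWalk μ W)
  ... | _ , eq′ = trans (sym (endpoint-mapWalk μ z₀ W)) (proj₁ (∷-injective (trans (sym eq′) eq)))

  -- powers of R are reduced walks, so they are recovered from their stacks
  pow-unstack : ∀ i → unstack (stack v (pow v R i)) ≡ pow v R i
  pow-unstack (+ zero) = refl
  pow-unstack (+ suc m) = cong unstack (stack-reduce v (powℕ v R m ++ R))
  pow-unstack -[1+ m ] = cong unstack (stack-reduce v (powℕ v (inv v R) m ++ inv v R))

  -- NoBoundedPower
  -- says x₀ is a prefix of no power of R with exponent bounded by the height of
  -- st₀; under it (and the assumptions of Growth) we derive a contradiction.
  module Against (W₀ : List (ProdV G H)) where
    st₀ : List (V K)
    st₀ = imageStack W₀

    x₀ : List (V K)
    x₀ = reduce v (mapWalk μ W₀)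

    NoBoundedPower : Set
    NoBoundedPower = ∀ i → BoundedExp (length st₀) i → ¬ IsPrefix x₀ (pow v R i)

    -- no closed walk at z₀ keeps st₀ at the bottom of its image stack, since the
    -- image of a closed walk reduces to a power of R
    no-closed-extension : NoBoundedPower → ∀ C → IsWalk Γ z₀ C → endpoint z₀ C ≡ z₀ →
                          ¬ Suffix st₀ (imageStack C)
    no-closed-extension none C walk closed sfx with closed-powers C walk closed
    ... | i , reduced≡pow
      with power-suffix-bounded (E K) (irrefl K) v R (proj₁ R∈π) (proj₁ (proj₂ R∈π)) (proj₂ (proj₂ R∈π))
             st₀ i (stack-wf v (mapWalk μ W₀)) (subst (Suffix st₀) (sym pow-stack) sfx)
      where
      pow-stack : stack v (pow v R i) ≡ imageStack C
      pow-stack = trans (cong (stack v) (sym reduced≡pow)) (stack-reduce v (mapWalk μ C))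
    ...   | i′ , bounded , sfx′ =
            none i′ bounded (subst (IsPrefix x₀) (pow-unstack i′)
                                   (suffix-prefix v st₀ _ (stack-wf v (mapWalk μ W₀)) sfx′))

    -- x₀ is nonempty (the empty walk is R⁰), so st₀ has at least two entries
    st₀-height : NoBoundedPower → 2 ≤ length st₀
    st₀-height none with stack-wf v (mapWalk μ W₀)
    ... | ([] , eq) , _ =
          ⊥-elim (none (+ 0) (0 , z≤n , inj₁ refl) (subst (λ S → IsPrefix (unstack S) []) (sym eq) ([] , refl)))
    ... | (m ∷ M , eq) , _ =
          subst (λ S → 2 ≤ length S) (sym eq) (s≤s (≤-trans (m≤n+m 1 (length M)) (≤-reflexive (sym (length-++ M)))))

    -- Assuming moreover that no layer is constant and that G has an odd closed
    -- walk, we push entries onto st₀ until walking back to z₀ cannot uncover it.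
    module Growth (none : NoBoundedPower) (notConstant : ¬ (∃[ h ] ∃[ c ] (∀ (g : V G) → μ (g , h) ≡ c)))
                  (odd : OddClosedWalk G) where
      open NonBipartite G connectedG
      open WithOddWalk odd
      open ReturnWalks G H connectedG connectedH odd g₀ h₀

      depth : ℕ
      depth = proj₁ return-bound

      -- the return walk to z₀ pops at most `depth` entries, so it leaves st₀ in place
      buried-too-deep : ∀ W e → IsWalk Γ z₀ W → imageStack W ≡ e ++ st₀ → depth ≤ length e → ⊥
      buried-too-deep W e walk eq deep = no-closed-extension none (W ++ L) (proj₁ (proj₂ C)) (proj₂ (proj₂ C)) st₀-kept
        where
        back = return-walk (endpoint z₀ W)
        L = proj₁ back
        C : Walk Γ z₀ z₀
        C = (W , walk , refl) ++ʷ back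
        pops = read-pops (mapWalk μ L) (imageStack W)
        S′ = proj₁ pops
        st₀≤S′ : length st₀ ≤ length S′
        st₀≤S′ = +-cancelˡ-≤ (length e) (length st₀) (length S′) (begin
          length e + length st₀              ≡⟨ sym (length-++ e) ⟩
          length (e ++ st₀)                  ≡⟨ cong length (sym eq) ⟩
          length (imageStack W)              ≤⟨ proj₂ (proj₂ (proj₂ pops)) ⟩
          length S′ + length (mapWalk μ L)   ≡⟨ cong (λ l → length S′ + l) (length-mapWalk μ L) ⟩
          length S′ + len back               ≤⟨ +-monoʳ-≤ (length S′) (≤-trans (proj₂ return-bound _) deep) ⟩
          length S′ + length e               ≡⟨ +-comm (length S′) (length e) ⟩
          length e + length S′               ∎)
          where open ≤-Reasoning
        st₀-kept : Suffix st₀ (imageStack (W ++ L))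
        st₀-kept = subst (Suffix st₀) (sym (imageStack-++ W L))
          (suffix-trans (suffix-compare (e , eq) (proj₁ (proj₂ pops)) st₀≤S′) (proj₁ (proj₂ (proj₂ pops))))

      -- A walk W whose image stack is a ∷ b ∷ rest cannot be stuck, i.e. without
      -- extension to a walk with image stack c ∷ a ∷ b ∷ rest.  Let h₁ be the layer
      -- W ends in, h′ a neighbour of h₁, and S the vertices g such that (g , h₁) is
      -- reached with stack a ∷ b ∷ rest.  If W were stuck, S would map to a and its
      -- neighbourhood in layer h′ to b; so S would be H-extremal or, lacking second
      -- neighbours, closed under two steps, hence all of V(G), and layer h₁ constant.
      module Stuck (W : List (ProdV G H)) (walk : IsWalk Γ z₀ W) (a b : V K) (rest : List (V K))
                   (top : imageStack W ≡ a ∷ b ∷ rest)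
                   (stuck : ∀ W′ c → IsWalk Γ z₀ W′ → imageStack W′ ≡ c ∷ a ∷ b ∷ rest → ⊥) where
        σ : List (V K)
        σ = a ∷ b ∷ rest

        g₁ : V G
        g₁ = proj₁ (endpoint z₀ W)

        h₁ : V H
        h₁ = proj₂ (endpoint z₀ W)

        h′ : V H
        h′ = proj₁ (noIso H h₁)

        h₁h′ : E H h₁ h′
        h₁h′ = proj₂ (noIso H h₁)

        σ-reduced : RS σ
        σ-reduced = subst RS top (proj₂ (stack-wf v (mapWalk μ W)))

        Reached : V G → Set
        Reached g = Σ (List (ProdV G H)) λ W′ →
                      IsWalk Γ z₀ W′ × endpoint z₀ W′ ≡ (g , h₁) × imageStack W′ ≡ σ

        reached-image : ∀ {g} → Reached g → μ (g , h₁) ≡ a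
        reached-image (W′ , _ , end , st) = trans (cong μ (sym end)) (image-top W′ st)

        -- a neighbour in layer h′ with image other than b would extend the stack
        step-out : ∀ {g g′} → Reached g → E G g g′ → μ (g′ , h′) ≡ b
        step-out {g} {g′} (W′ , walk′ , end , st) e with μ (g′ , h′) ≟ b
        ... | yes eq = eq
        ... | no neq = ⊥-elim (stuck (W′ ++ (g′ , h′) ∷ []) (μ (g′ , h′)) walk″ stack″)
          where
          walk″ : IsWalk Γ z₀ (W′ ++ (g′ , h′) ∷ [])
          walk″ = isWalk-++ walk′ (subst (λ z → IsWalk Γ z ((g′ , h′) ∷ [])) (sym end) (cons (e , h₁h′) nil))
          stack″ : imageStack (W′ ++ (g′ , h′) ∷ []) ≡ μ (g′ , h′) ∷ σ
          stack″ = trans (imageStack-++ W′ ((g′ , h′) ∷ []))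
                         (trans (cong (λ S → push S (μ (g′ , h′))) st) (push-push a b rest (μ (g′ , h′)) neq))

        -- stepping out to layer h′ and back to a vertex with image a restores the stack
        step-back : ∀ {g g′ g″} → Reached g → E G g g′ → E G g′ g″ → μ (g″ , h₁) ≡ a → Reached g″
        step-back {g} {g′} {g″} r@(W′ , walk′ , end , st) e e′ image = W′ ++ L , walk″ , end″ , stack″
          where
          L = (g′ , h′) ∷ (g″ , h₁) ∷ []
          walk″ : IsWalk Γ z₀ (W′ ++ L)
          walk″ = isWalk-++ walk′ (subst (λ z → IsWalk Γ z L) (sym end)
                                         (cons (e , h₁h′) (cons (e′ , graph-sym H h₁h′) nil)))
          end″ : endpoint z₀ (W′ ++ L) ≡ (g″ , h₁)
          end″ = trans (endpoint-++ z₀ W′ L) (cong (λ z → endpoint z L) end)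
          stack″ : imageStack (W′ ++ L) ≡ σ
          stack″ = begin
            imageStack (W′ ++ L)                                     ≡⟨ imageStack-++ W′ L ⟩
            push (push (imageStack W′) (μ (g′ , h′))) (μ (g″ , h₁))
              ≡⟨ cong₂ (λ S x → push (push S (μ (g′ , h′))) x) st image ⟩
            push (push σ (μ (g′ , h′))) a     ≡⟨ cong (λ x → push (push σ x) a) (step-out r e) ⟩
            push (push σ b) a                 ≡⟨ push-backtrack a b rest σ-reduced ⟩
            σ                                 ∎
            where open ≡-Reasoning

        module Decided (reached? : ∀ g → Dec (Reached g)) where
          S : Subset (n G)
          S = subsetOf reached?

          S-image : ∀ g → g ∈ S → μ (g , h₁) ≡ a
          S-image g g∈S = reached-image (subsetOf-∈ reached? g g∈S)

          N-image : ∀ g′ → InN G S g′ → μ (g′ , h′) ≡ b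
          N-image g′ (g , g∈S , e) = step-out (subsetOf-∈ reached? g g∈S) e

          N²-image : ∀ g″ → InN2 G S g″ → μ (g″ , h₁) ≢ a
          N²-image g″ ((g′ , (g , g∈S , e) , e′) , g″∉S) image =
            g″∉S (∈-subsetOf reached? g″ (step-back (subsetOf-∈ reached? g g∈S) e e′ image))

          g₁∈S : g₁ ∈ S
          g₁∈S = ∈-subsetOf reached? g₁ (W , walk , refl , top)

          extremal : (∃[ g″ ] InN2 G S g″) → HExtremal G H K μ S h′ h₁
          extremal N²-inhabited =
            graph-sym H h₁h′ , a , b , ((g₁ , g₁∈S) , S-image) ,
            ((proj₁ (noIso G g₁) , g₁ , g₁∈S , proj₂ (noIso G g₁)) , N-image) ,
            N²-inhabited , N²-image

          -- without second neighbours S is closed under two steps; since G has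
          -- even walks between any two vertices, S is everything
          everything : ¬ (∃[ g″ ] InN2 G S g″) → ∀ g → g ∈ S
          everything noN² g =
            even-walk-transport (_∈ S) closed (proj₁ even-walk) (proj₂ even-walk) g₁∈S
            where
            even-walk = walk-of-parity g₁ g 0ℙ
            closed : ∀ {g g′ g″} → g ∈ S → E G g g′ → E G g′ g″ → g″ ∈ S
            closed {g} {g′} {g″} g∈S e e′ with g″ ∈? S
            ... | yes g″∈S = g″∈S
            ... | no g″∉S = ⊥-elim (noN² (g″ , (g′ , (g , g∈S , e) , e′) , g″∉S))

          impossible : ⊥
          impossible = ¬¬-excluded-middle λ
            { (yes N²-inhabited) → noExtremal S h′ h₁ (extremal N²-inhabited)
            ; (no noN²) → notConstant (h₁ , a , λ g → S-image g (everything noN² g)) }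

        impossible : ⊥
        impossible = ¬¬-decidable-on-Fin (n G) Reached Decided.impossible

      height : ∀ {S} → Suffix st₀ S → 2 ≤ length S
      height sfx = ≤-trans (st₀-height none) (suffix-length sfx)

      bury : ∀ f W e → IsWalk Γ z₀ W → imageStack W ≡ e ++ st₀ → depth ≤ length e + f → ⊥
      bury zero W e walk eq deep = buried-too-deep W e walk eq (subst (depth ≤_) (+-identityʳ (length e)) deep)
      bury (suc f) W e walk eq deep with two-heads (imageStack W) (height (e , eq))
      ... | a , b , rest , top = Stuck.impossible W walk a b rest top λ W′ c walk′ top′ →
            bury f W′ (c ∷ e) walk′ (trans top′ (cong (c ∷_) (trans (sym top) eq)))
                 (subst (depth ≤_) (+-suc (length e) f) deep)

      absurd : IsWalk Γ z₀ W₀ → ⊥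
      absurd walk₀ = bury depth W₀ [] walk₀ refl ≤-refl

lemma16 : (G H K : Graph) (μ : ProdV G H → V K) → IsHom G H K μ →
    SquareFree K → Connected G → Connected H → ¬ Bipartite G →
    NoHExtremal G H K μ →
    (g₀ : V G) (h₀ : V H) (R : List (V K)) → InPi K (μ (g₀ , h₀)) R →
    (∀ (C : List (ProdV G H)) → IsWalk (ProdE G H) (g₀ , h₀) C →
       endpoint (g₀ , h₀) C ≡ (g₀ , h₀) →
       ∃[ i ] (reduce (μ (g₀ , h₀)) (mapWalk μ C) ≡ pow (μ (g₀ , h₀)) R i)) →
    (∃[ h ] ∃[ c ] (∀ (g : V G) → μ (g , h) ≡ c))
    ⊎ (∀ (W : List (ProdV G H)) → IsWalk (ProdE G H) (g₀ , h₀) W →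
         ∃[ i ] IsPrefix (reduce (μ (g₀ , h₀)) (mapWalk μ W)) (pow (μ (g₀ , h₀)) R i))
lemma16 G H K μ _ _ connectedG connectedH nonBipartite noExtremal g₀ h₀ R R∈π closed-powers
  with constant-layer? G H K μ g₀
... | yes constant = inj₁ constant
... | no notConstant = inj₂ prefix-of-power
  where
  open Main G H K μ connectedG connectedH noExtremal g₀ h₀ R R∈π closed-powers
  open NonBipartite G connectedG using (odd-closed-walk)
  -- search the finitely many bounded exponents; if none works, the walk leads to
  -- a contradiction (which needs an odd closed walk, available as G is not bipartite)
  prefix-of-power : ∀ W → IsWalk Γ z₀ W → ∃[ i ] IsPrefix (reduce v (mapWalk μ W)) (pow v R i)
  prefix-of-power W walk with search-exponents _≟_ (pow v R) (reduce v (mapWalk μ W)) (length (imageStack W))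
  ... | inj₁ found = found
  ... | inj₂ none = ⊥-elim (odd-closed-walk g₀ nonBipartite λ odd →
                      Against.Growth.absurd W none notConstant odd walk)
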